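{- Let $\Gamma=(G_0,\ldots,G_{n-1})$ be parametric games, $I\subseteq\mathrm{Par}$ a self-dual set of parameters, and $G=\forall I.\Gamma$. Let $p\in|G|_{\le\infty}$ be a non-repeating (finite or infinite) play of $G$ and let $G_i$ be a local position of $p$ with index $i$. Let $q\in|G_i|_\infty$ be an infinite play of $G_i$, and let $\tau_i=\{r\in|G_i| : r\prec_i p\}$ be the $p$-counter-strategy on $G_i$. Then: (1) if $r\prec_i p$ for every finite proper prefix $r$ of $q$, then $q\prec_i p$; (2) if $q$ is an infinite branch of $\tau_i$ (i.e. all finite prefixes of $q$ lie in $\tau_i$), then $q\prec_i p$.
   Context: Players: $\mathsf P$ (Player) and $\mathsf O$ (Opponent), with $\mathsf P^\bot=\mathsf O$, $\mathsf O^\bot=\mathsf P$. Fix a countable set $M$ of moves and a countable set $\mathrm{Par}$ of parameters with an involution $a\mapsto a^\bot$ without fixed points; $J\subseteq \mathrm{Par}$ is self-dual if $J^\bot=J$. Lists: $\langle\rangle$ is the empty list, $x@y$ concatenation (also with single elements). A tree support is a set $T$ of finite lists over $M$ containing $\langle\rangle$ and closed under prefixes; its leaves are the nodes with no one-step extension in $T$; $T_\infty$ is the set of infinite sequences all of whose finite prefixes lie in $T$, and $T_{\le\infty}=T\cup T_\infty$. A parametric game $G$ consists of a tree support $|G|$ (positions) with an enumeration of the children of each node, a map $\mathrm{turn}_G$ from non-leaf positions to $\{\mathsf P,\mathsf O\}$, a map $\mathrm{win}_G$ from leaves to $\{\mathsf P,\mathsf O\}\cup\mathrm{Par}$, and a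 partition $(G_{\mathsf P},G_{\mathsf O})$ of $|G|_\infty$. $\mathrm{FV}(G)$ is the smallest self-dual set containing $\mathrm{win}_G(\text{leaves})\cap\mathrm{Par}$. For $x\in|G|$, $G_x$ is the subgame with positions $\{y: x@y\in|G|\}$ and all data inherited via $y\mapsto x@y$. For $x\in\{\mathsf P,\mathsf O\}\cup\mathrm{Par}$, $\mathrm{END}(x)$ is the game whose only position is the root, a leaf labelled $x$; $G$ is atomic if $|G|=\{\langle\rangle\}$. A strategy $\sigma:G$ is a tree support $\sigma\subseteq|G|$. The game $G=\forall I.\Gamma$: $M$ contains injective constructors $\mathrm{DROP}(n),\mathrm{EM}(n,m),\mathrm{STOP}(n),\mathrm{JUST}(n,m),\mathrm{nth}(n)$ ($n,m\in\mathbb N$) with pairwise disjoint ranges covering $M$. Let $\mathrm{FV}(\Gamma)=\bigcup_i\mathrm{FV}(G_i)$. Each position carries a list of local positions (parametric games) and a justification relation. The root has local positions $G_0,\ldots,G_{n-1}$. If $p=\langle \mathrm{JUST}(i_0,n),m_0,\ldots,\mathrm{JUST}(i_{k-1},n+k-1),m_{k-1}\rangle$ is a position with local positions $G_0,\ldots,G_{n+k-1}$, then $\mathrm{turn}_G(p)=\mathsf P$ and $p@m$ is a position iff: (a) $m=\mathrm{DROP}(n+k)$; or (b) $m=\mathrm{EM}(i,j)$, $i,j<n+k$, $G_i=\mathrm{END}(a)$, $G_j=\mathrm{END}(a^\bot)$ for some $a\in I$; or (c) $m=\mathrm{STOP}(i)$, $i<n+k$, $G_i=\mathrm{END}(x)$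 with $x\in\{\mathsf P,\mathsf O\}\cup(\mathrm{FV}(\Gamma)\setminus I)$; or (d) $m=\mathrm{JUST}(i_k,n+k)$ with $i_k<n+k$ and $G_{i_k}$ not atomic. The positions in (a),(b),(c) are leaves with winner $\mathsf O$, $\mathsf P$, $\mathrm{win}_{G_i}(\langle\rangle)$ respectively. If $p_1=p@\mathrm{JUST}(i_k,n+k)$ then $\mathrm{turn}_G(p_1)=\mathrm{turn}_{G_{i_k}}(\langle\rangle)$ and $p_1@m_k$ is a position iff $\langle m_k\rangle\in|G_{i_k}|$; its local positions are $G_0,\ldots,G_{n+k}$ with $G_{n+k}=(G_{i_k})_{\langle m_k\rangle}$, and we write $i_k\vdash_{m_k} n+k$. For an infinite play, local positions and justifications are those of its finite prefixes. For a play $p$, an index $i$ of a local position and a finite list $q=\langle m_0,\ldots,m_{r-1}\rangle$, we write $q\prec_i p$ if there are indices $i=j_0<j_1<\cdots<j_r$ with $j_s\vdash_{m_s}j_{s+1}$ in $p$ for all $s<r$; for infinite $q=\langle m_0,m_1,\ldots\rangle$, $q\prec_i p$ if there is an infinite such chain $i=j_0<j_1<\cdots$. $G_{\mathsf P}$ is the set of infinite plays $p$ such that some infinite $q\prec_i p$ with $i<n$ lies in $(G_i)_{\mathsf P}$; $G_{\mathsf O}$ is the set of the other infinite plays. A move $m$ is not repeated in $p$ from $G_i$ if for all indices $j,k$ of local positions of $p$, $i\vdash_m j$ and $i\vdash_m k$ imply $j=k$; $p$ is non-repeating if no move is repeated in $p$ from any local position. -}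

module Defs where

open import Level using (Level)
open import Data.Nat using (ℕ; zero; suc; _+_; _*_; _<_)
open import Data.List using (List; []; _∷_; _++_; [_]; length)
open import Data.List.Properties using (++-identityʳ; ++-assoc)
open import Data.Maybe using (Maybe; just; nothing)
open import Data.Product using (Σ; ∃; ∃-syntax; _×_; _,_)
open import Data.Sum using (_⊎_; inj₁; inj₂)
open import Relation.Nullary using (¬_)
open import Relation.Binary.PropositionalEquality using (_≡_; _≢_; subst; sym)
open import Function.Definitions using (Injective)

data Player : Set where
  P O : Player

-- Moves: M is covered by the pairwise disjoint ranges of the injective
-- constructors DROP, EM, STOP, JUST, nth; so M is this datatype.

data Move : Set where
  DROP : ℕ → Move
  EM   : ℕ → ℕ → Move
  STOP : ℕ → Move
  JUST : ℕ → ℕ → Move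
  nth  : ℕ → Move

takeS : {A : Set} → ℕ → (ℕ → A) → List A
takeS zero    s = []
takeS (suc n) s = s 0 ∷ takeS n (λ k → s (suc k))

_++ₛ_ : {A : Set} → List A → (ℕ → A) → (ℕ → A)
([] ++ₛ s) k = s k
((x ∷ xs) ++ₛ s) zero = x
((x ∷ xs) ++ₛ s) (suc k) = (xs ++ₛ s) k

_!!_ : ∀ {a} {A : Set a} → List A → ℕ → Maybe A
[] !! k = nothing
(x ∷ xs) !! zero = just x
(x ∷ xs) !! suc k = xs !! k

record ParSpace : Set₁ where
  field
    Par      : Set
    _ᗮ       : Par → Par
    ᗮ-invol  : ∀ a → (a ᗮ) ᗮ ≡ a
    ᗮ-nofix  : ∀ a → a ᗮ ≢ a
    encode   : Par → ℕ
    encode-injective : Injective _≡_ _≡_ encode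

module _ (Π : ParSpace) where
  open ParSpace Π

  data Outcome : Set where
    player : Player → Outcome
    par    : Par → Outcome

  SelfDual : (Par → Set) → Set
  SelfDual J = ∀ a → J a → J (a ᗮ)

  -- Parametric games.  turn and win are total functions; only their
  -- values on non-leaf positions (resp. leaves) are meaningful.
  -- winP is the set G_P of infinite plays; G_O is its complement
  -- in |G|_∞.

  record Game : Set₁ where
    field
      pos        : List Move → Set
      pos-root   : pos []
      pos-prefix : ∀ x y → pos (x ++ y) → pos x
      turn       : List Move → Player
      win        : List Move → Outcome
      winP       : (ℕ → Move) → Set

  open Game public

  Leaf : Game → List Move → Set
  Leaf G x = pos G x × (∀ m → ¬ pos G (x ++ [ m ]))

  InfPlay : Game → (ℕ → Move) → Set
  InfPlay G q = ∀ n → pos G (takeS n q)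

  Atomic : Game → Set
  Atomic G = ∀ x → pos G x → x ≡ []

  IsEND : Game → Outcome → Set
  IsEND G o = Atomic G × win G [] ≡ o

  -- FV(G): smallest self-dual set containing the parameters labelling leaves
  FV : Game → Par → Set
  FV G a = ∃[ x ] (Leaf G x × (win G x ≡ par a ⊎ win G x ≡ par (a ᗮ)))

  FVΓ : List Game → Par → Set₁
  FVΓ Γ a = ∃[ i ] ∃[ G ] (Γ !! i ≡ just G × FV G a)

  sub : (G : Game) (x : List Move) → pos G x → Game
  pos        (sub G x h₀) y = pos G (x ++ y)
  pos-root   (sub G x h₀)   = subst (pos G) (sym (++-identityʳ x)) h₀
  pos-prefix (sub G x h₀) y z h =
    pos-prefix G (x ++ y) z (subst (pos G) (sym (++-assoc x y z)) h)
  turn       (sub G x h₀) y = turn G (x ++ y)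
  win        (sub G x h₀) y = win G (x ++ y)
  winP       (sub G x h₀) s = winP G (x ++ₛ s)

  module _ (I : Par → Set) (Γ : List Game) where

    -- Reach p Δ : p = ⟨JUST(i₀,n),m₀,…,JUST(i_{k-1},n+k-1),m_{k-1}⟩ is a
    -- position with local positions Δ = G₀,…,G_{n+k-1}
    data Reach : List Move → List Game → Set₁ where
      start : Reach [] Γ
      step  : ∀ {p Δ i g m} → Reach p Δ → i < length Δ → Δ !! i ≡ just g →
              ¬ Atomic g → (h : pos g [ m ]) →
              Reach (p ++ (JUST i (length Δ) ∷ m ∷ []))
                    (Δ ++ [ sub g [ m ] h ])

    data LastMove (Δ : List Game) : Move → Set₁ where
      drop : LastMove Δ (DROP (length Δ))
      em   : ∀ {i j gi gj a} → i < length Δ → j < length Δ →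
             Δ !! i ≡ just gi → Δ !! j ≡ just gj →
             IsEND gi (par a) → IsEND gj (par (a ᗮ)) → I a →
             LastMove Δ (EM i j)
      stopP : ∀ {i gi x} → i < length Δ → Δ !! i ≡ just gi →
              IsEND gi (player x) → LastMove Δ (STOP i)
      stopA : ∀ {i gi a} → i < length Δ → Δ !! i ≡ just gi →
              IsEND gi (par a) → FVΓ Γ a → ¬ I a → LastMove Δ (STOP i)
      just  : ∀ {i gi} → i < length Δ → Δ !! i ≡ just gi →
              ¬ Atomic gi → LastMove Δ (JUST i (length Δ))

    Pos : List Move → Set₁
    Pos p = (∃[ Δ ] Reach p Δ)
          ⊎ (∃[ p′ ] ∃[ Δ ] ∃[ m ] (Reach p′ Δ × LastMove Δ m × p ≡ p′ ++ [ m ]))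

  data Play : Set where
    fin : List Move → Play
    inf : (ℕ → Move) → Play

  seqOf : Play → ℕ → Maybe Move
  seqOf (fin p) k = p !! k
  seqOf (inf s) k = just (s k)

  InPlays : (Par → Set) → List Game → Play → Set₁
  InPlays I Γ (fin p) = Pos I Γ p
  InPlays I Γ (inf s) = ∀ n → Pos I Γ (takeS n s)

  -- Justification: j ⊢_m l in p iff p contains JUST(j,l), m as the
  -- k-th pair (positions 2k, 2k+1) for some k.

  Justifies : (ℕ → Maybe Move) → ℕ → Move → ℕ → Set
  Justifies s j m l =
    ∃[ k ] (s (2 * k) ≡ just (JUST j l) × s (suc (2 * k)) ≡ just m)

  -- local positions of p: LocalPos Γ s i G means G_i = G
  data LocalPos (Γ : List Game) (s : ℕ → Maybe Move) : ℕ → Game → Set₁ where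
    base : ∀ {i G} → Γ !! i ≡ just G → LocalPos Γ s i G
    ext  : ∀ {j m l G} → LocalPos Γ s j G → Justifies s j m l →
           (h : pos G [ m ]) → LocalPos Γ s l (sub G [ m ] h)

  data Prec (s : ℕ → Maybe Move) : ℕ → List Move → Set where
    []  : ∀ {i} → Prec s i []
    _∷_ : ∀ {i j m q} → (i < j × Justifies s i m j) → Prec s j q →
          Prec s i (m ∷ q)

  PrecInf : (ℕ → Maybe Move) → ℕ → (ℕ → Move) → Set
  PrecInf s i q = Σ (ℕ → ℕ) λ f → (f 0 ≡ i ×
                  (∀ r → f r < f (suc r) × Justifies s (f r) (q r) (f (suc r))))

  NonRepeating : (ℕ → Maybe Move) → Set
  NonRepeating s = ∀ i m j k → Justifies s i m j → Justifies s i m k → j ≡ k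

  CounterStrategy : Game → (ℕ → Maybe Move) → ℕ → List Move → Set
  CounterStrategy Gi s i r = pos Gi r × Prec s i r

-- A chain witnessing r ≺_i p is determined by r when p is non-repeating:
-- each step j ⊢_m k has only one possible target k.  Hence the chains for
-- the finite prefixes of q all extend one another, and reading off their
-- endpoints gives an infinite chain, i.e. q ≺_i p.
module Submission where

open import Defs
open import Data.Nat using (ℕ; zero; suc; _<_)
open import Data.List using (List; []; _∷_; _++_; [_])
open import Data.Maybe using (Maybe)
open import Data.Product using (_×_; _,_; Σ; proj₂)
open import Relation.Binary.PropositionalEquality using (_≡_; refl; cong)

takeS-suc : ∀ {A : Set} r (q : ℕ → A) → takeS (suc r) q ≡ takeS r q ++ [ q r ]
takeS-suc zero    q = refl
takeS-suc (suc r) q = cong (q 0 ∷_) (takeS-suc r (λ k → q (suc k)))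

module _ (Π : ParSpace) (s : ℕ → Maybe Move) where

  endpoint : ∀ {i r} → Prec Π s i r → ℕ
  endpoint {i} []      = i
  endpoint     (_ ∷ c) = endpoint c

  endpoint-[] : ∀ {i} (c : Prec Π s i []) → endpoint c ≡ i
  endpoint-[] [] = refl

  endpoint-unique : NonRepeating Π s → ∀ {i r} (c d : Prec Π s i r) →
                    endpoint c ≡ endpoint d
  endpoint-unique nr [] [] = refl
  endpoint-unique nr (_∷_ {i} {j} {m} (_ , i⊢j) c) (_∷_ {j = k} (_ , i⊢k) d)
    with nr i m j k i⊢j i⊢k
  ... | refl = endpoint-unique nr c d

  Prec-unsnoc : ∀ {i r} xs m → r ≡ xs ++ [ m ] → (c : Prec Π s i r) →
                Σ (Prec Π s i xs) λ c′ →
                  endpoint c′ < endpoint c × Justifies Π s (endpoint c′) m (endpoint c)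
  Prec-unsnoc []       m refl (link ∷ []) = [] , link
  Prec-unsnoc (x ∷ xs) m refl (link ∷ c) with Prec-unsnoc xs m refl c
  ... | c′ , last = (link ∷ c′) , last

  Prec-prefixes⇒PrecInf : NonRepeating Π s → ∀ i (q : ℕ → Move) →
                          (∀ n → Prec Π s i (takeS n q)) → PrecInf Π s i q
  Prec-prefixes⇒PrecInf nr i q chain =
    (λ n → endpoint (chain n)) , endpoint-[] (chain 0) , extends
    where
    extends : ∀ r → endpoint (chain r) < endpoint (chain (suc r))
                  × Justifies Π s (endpoint (chain r)) (q r) (endpoint (chain (suc r)))
    extends r with Prec-unsnoc (takeS r q) (q r) (takeS-suc r q) (chain (suc r))
    ... | c′ , last rewrite endpoint-unique nr c′ (chain r) = last

mainTheorem1 : (Π : ParSpace) (Γ : List (Game Π)) (I : ParSpace.Par Π → Set) →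
               SelfDual Π I →
               (p : Play Π) → InPlays Π I Γ p →
               NonRepeating Π (seqOf Π p) →
               (i : ℕ) (Gi : Game Π) → LocalPos Π Γ (seqOf Π p) i Gi →
               (q : ℕ → Move) → InfPlay Π Gi q →
               (((n : ℕ) → Prec Π (seqOf Π p) i (takeS n q)) → PrecInf Π (seqOf Π p) i q)
               × (((n : ℕ) → CounterStrategy Π Gi (seqOf Π p) i (takeS n q)) → PrecInf Π (seqOf Π p) i q)
mainTheorem1 Π Γ I _ p _ nr i Gi _ q _ =
  Prec-prefixes⇒PrecInf Π (seqOf Π p) nr i q ,
  λ branch → Prec-prefixes⇒PrecInf Π (seqOf Π p) nr i q (λ n → proj₂ (branch n))
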